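{- Let $\mathsf{Counter}$ be the record type $\{\mathsf{incr} : \mathsf{T}\,\mathsf{unit};\ \mathsf{read} : \mathsf{T}\,\mathsf{Int}\}$ and define the closed terms $$\mathsf{posCounter} :\equiv \ell\gets \mathsf{alloc}\,0;\ \mathsf{ret}\,\{\mathsf{incr}\hookrightarrow i\gets \mathsf{get}\,\ell;\ \mathsf{set}\,\ell\,(i+1),\ \mathsf{read}\hookrightarrow \mathsf{get}\,\ell\},$$ $$\mathsf{negCounter} :\equiv \ell\gets \mathsf{alloc}\,0;\ \mathsf{ret}\,\{\mathsf{incr}\hookrightarrow i\gets \mathsf{get}\,\ell;\ \mathsf{set}\,\ell\,(i-1),\ \mathsf{read}\hookrightarrow \mathsf{map}\,\mathsf{neg}\,(\mathsf{get}\,\ell)\},$$ where $\mathsf{neg}:\mathsf{Int}\to\mathsf{Int}$ is negation. Then the equation $\vdash \mathsf{posCounter}\equiv\mathsf{negCounter}$ is derivable in the equational theory of univalent reference types (at type $\mathsf{T}\,\mathsf{Counter}$).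
   Context: The language is a monadic metalanguage: a simply typed $\lambda$-calculus with function, unit, product (and record) types and a type $\mathsf{Int}$ of integers with the usual arithmetic operations ($+$, $-$, negation $\mathsf{neg}$) and their standard equations, together with a strong monad $\mathsf{T}$ (notation: $x\gets e; e'$ for bind, $e;e'$ for $\_\gets e;e'$, $\mathsf{ret}$ for the unit, and $\mathsf{map}\,f:\mathsf{T}\,A\to\mathsf{T}\,B$ for the functorial action of $\mathsf{T}$ on $f:A\to B$), and a type former $\mathsf{Ref}\,\tau$ of references. Typing rules: if $\Gamma\vdash e:\sigma$ then $\Gamma\vdash\mathsf{alloc}\,e:\mathsf{T}(\mathsf{Ref}\,\sigma)$; if $\Gamma\vdash e:\mathsf{Ref}\,\sigma$ then $\Gamma\vdash\mathsf{get}\,e:\mathsf{T}\,\sigma$; if $\Gamma\vdash e:\mathsf{Ref}\,\sigma$ and $\Gamma\vdash e':\sigma$ then $\Gamma\vdash \mathsf{set}\,e\,e':\mathsf{T}\,\mathsf{unit}$; $\Gamma\vdash\mathsf{step}:\mathsf{T}\,\mathsf{unit}$; and if $\Gamma,f:\sigma\to\mathsf{T}\tau,x:\sigma\vdash e:\mathsf{T}\tau$ then $\Gamma\vdash \mathsf{rec}\,f\,x.\,e:\sigma\to\mathsf{T}\tau$. The base equational theory consists of: the $\beta\eta$-laws for function and product types; the monad laws; centrality of $\mathsf{step}$ (it commutes with all monadic operations); $(\mathsf{rec}\,f\,x.\,e)\,e'\equiv \mathsf{step};[(\mathsf{rec}\,f\,x.\,e)/f,e'/x]e$; and for $e:\mathsf{Ref}\,\sigma$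 etc.: $\mathsf{set}\,e\,e';\mathsf{get}\,e\equiv\mathsf{step};\mathsf{set}\,e\,e';\mathsf{ret}\,e'$; $(x\gets\mathsf{alloc}\,e;\mathsf{set}\,x\,e)\equiv\mathsf{alloc}\,e$; $\mathsf{set}\,e\,e';\mathsf{set}\,e\,e''\equiv\mathsf{set}\,e\,e''$; $(x\gets\mathsf{get}\,e;y\gets\mathsf{get}\,e';\mathsf{ret}\langle x,y\rangle)\equiv(y\gets\mathsf{get}\,e';x\gets\mathsf{get}\,e;\mathsf{ret}\langle x,y\rangle)$; $(x\gets\mathsf{get}\,e;\mathsf{set}\,e\,x)\equiv\mathsf{get}\,e$; and $\mathsf{get}\,e;e'\equiv\mathsf{step};e'$ for $e':\mathsf{T}\tau$. The theory of univalent reference types adds two rules. Allocation permutation: for $\Gamma\vdash e:\sigma$, $\Gamma\vdash e':\tau$, $\ell\gets\mathsf{alloc}\,e;\ell'\gets\mathsf{alloc}\,e';\mathsf{ret}\langle\ell,\ell'\rangle\equiv\ell'\gets\mathsf{alloc}\,e';\ell\gets\mathsf{alloc}\,e;\mathsf{ret}\langle\ell,\ell'\rangle : \mathsf{T}(\mathsf{Ref}\,\sigma\times\mathsf{Ref}\,\tau)$. Representation independence: writing $\mathsf{Cell}\,\sigma:\equiv\mathsf{T}\,\sigma\times(\sigma\to\mathsf{T}\,\mathsf{unit})$, if $\Gamma\vdash e:\sigma$, $\Gamma\vdash f^+:\sigma\to\tau$, $\Gamma\vdash f^-:\tau\to\sigma$ with $f^+(f^-x)\equiv x$ and $f^-(f^+x)\equiv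 x$, then $\ell\gets\mathsf{alloc}\,e;\mathsf{ret}\langle\mathsf{get}\,\ell,\mathsf{set}\,\ell\rangle\equiv\ell\gets\mathsf{alloc}\,(f^+e);\mathsf{ret}\langle\mathsf{map}\,f^-(\mathsf{get}\,\ell),\ \mathsf{set}\,\ell\circ f^+\rangle:\mathsf{T}(\mathsf{Cell}\,\sigma)$. -}

module Defs where

open import Data.Integer as ℤ using (ℤ)

infixr 7 _⇒_
infixr 8 _×ᵗ_

data Ty : Set where
  unit : Ty
  int  : Ty
  _⇒_  : Ty → Ty → Ty
  _×ᵗ_ : Ty → Ty → Ty
  T    : Ty → Ty
  Ref  : Ty → Ty

infixl 5 _▸_
data Ctx : Set where
  ∅   : Ctx
  _▸_ : Ctx → Ty → Ctx

infix 4 _∋_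
data _∋_ : Ctx → Ty → Set where
  vz : ∀ {Γ A} → Γ ▸ A ∋ A
  vs : ∀ {Γ A B} → Γ ∋ A → Γ ▸ B ∋ A

infix 4 _⊢_
data _⊢_ : Ctx → Ty → Set where
  var    : ∀ {Γ A} → Γ ∋ A → Γ ⊢ A
  lam    : ∀ {Γ A B} → Γ ▸ A ⊢ B → Γ ⊢ A ⇒ B
  app    : ∀ {Γ A B} → Γ ⊢ A ⇒ B → Γ ⊢ A → Γ ⊢ B
  tt     : ∀ {Γ} → Γ ⊢ unit
  pair   : ∀ {Γ A B} → Γ ⊢ A → Γ ⊢ B → Γ ⊢ A ×ᵗ B
  fst    : ∀ {Γ A B} → Γ ⊢ A ×ᵗ B → Γ ⊢ A
  snd    : ∀ {Γ A B} → Γ ⊢ A ×ᵗ B → Γ ⊢ B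
  lit    : ∀ {Γ} → ℤ → Γ ⊢ int
  plus   : ∀ {Γ} → Γ ⊢ int → Γ ⊢ int → Γ ⊢ int
  minus  : ∀ {Γ} → Γ ⊢ int → Γ ⊢ int → Γ ⊢ int
  negate : ∀ {Γ} → Γ ⊢ int → Γ ⊢ int
  ret    : ∀ {Γ A} → Γ ⊢ A → Γ ⊢ T A
  bind   : ∀ {Γ A B} → Γ ⊢ T A → Γ ▸ A ⊢ T B → Γ ⊢ T B   -- x ← e ; e'
  alloc  : ∀ {Γ A} → Γ ⊢ A → Γ ⊢ T (Ref A)
  get    : ∀ {Γ A} → Γ ⊢ Ref A → Γ ⊢ T A
  set    : ∀ {Γ A} → Γ ⊢ Ref A → Γ ⊢ A → Γ ⊢ T unit
  step   : ∀ {Γ} → Γ ⊢ T unit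
  rec    : ∀ {Γ A B} → Γ ▸ (A ⇒ T B) ▸ A ⊢ T B → Γ ⊢ A ⇒ T B

Ren : Ctx → Ctx → Set
Ren Γ Δ = ∀ {A} → Γ ∋ A → Δ ∋ A

ext : ∀ {Γ Δ B} → Ren Γ Δ → Ren (Γ ▸ B) (Δ ▸ B)
ext ρ vz     = vz
ext ρ (vs x) = vs (ρ x)

rename : ∀ {Γ Δ} → Ren Γ Δ → ∀ {A} → Γ ⊢ A → Δ ⊢ A
rename ρ (var x)      = var (ρ x)
rename ρ (lam e)      = lam (rename (ext ρ) e)
rename ρ (app e e₁)   = app (rename ρ e) (rename ρ e₁)
rename ρ tt           = tt
rename ρ (pair e e₁)  = pair (rename ρ e) (rename ρ e₁)
rename ρ (fst e)      = fst (rename ρ e)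
rename ρ (snd e)      = snd (rename ρ e)
rename ρ (lit n)      = lit n
rename ρ (plus e e₁)  = plus (rename ρ e) (rename ρ e₁)
rename ρ (minus e e₁) = minus (rename ρ e) (rename ρ e₁)
rename ρ (negate e)   = negate (rename ρ e)
rename ρ (ret e)      = ret (rename ρ e)
rename ρ (bind e e₁)  = bind (rename ρ e) (rename (ext ρ) e₁)
rename ρ (alloc e)    = alloc (rename ρ e)
rename ρ (get e)      = get (rename ρ e)
rename ρ (set e e₁)   = set (rename ρ e) (rename ρ e₁)
rename ρ step         = step
rename ρ (rec e)      = rec (rename (ext (ext ρ)) e)

wk : ∀ {Γ A B} → Γ ⊢ A → Γ ▸ B ⊢ A
wk = rename vs

Sub : Ctx → Ctx → Set
Sub Γ Δ = ∀ {A} → Γ ∋ A → Δ ⊢ A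

exts : ∀ {Γ Δ B} → Sub Γ Δ → Sub (Γ ▸ B) (Δ ▸ B)
exts σ vz     = var vz
exts σ (vs x) = wk (σ x)

subst : ∀ {Γ Δ} → Sub Γ Δ → ∀ {A} → Γ ⊢ A → Δ ⊢ A
subst σ (var x)      = σ x
subst σ (lam e)      = lam (subst (exts σ) e)
subst σ (app e e₁)   = app (subst σ e) (subst σ e₁)
subst σ tt           = tt
subst σ (pair e e₁)  = pair (subst σ e) (subst σ e₁)
subst σ (fst e)      = fst (subst σ e)
subst σ (snd e)      = snd (subst σ e)
subst σ (lit n)      = lit n
subst σ (plus e e₁)  = plus (subst σ e) (subst σ e₁)
subst σ (minus e e₁) = minus (subst σ e) (subst σ e₁)
subst σ (negate e)   = negate (subst σ e)
subst σ (ret e)      = ret (subst σ e)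
subst σ (bind e e₁)  = bind (subst σ e) (subst (exts σ) e₁)
subst σ (alloc e)    = alloc (subst σ e)
subst σ (get e)      = get (subst σ e)
subst σ (set e e₁)   = set (subst σ e) (subst σ e₁)
subst σ step         = step
subst σ (rec e)      = rec (subst (exts (exts σ)) e)

sub1 : ∀ {Γ B} → Γ ⊢ B → Sub (Γ ▸ B) Γ
sub1 e' vz     = e'
sub1 e' (vs x) = var x

_[_] : ∀ {Γ A B} → Γ ▸ B ⊢ A → Γ ⊢ B → Γ ⊢ A
e [ e' ] = subst (sub1 e') e

-- double substitution  [f'/f, x'/x]e  (f is the outer, x the inner variable)
sub2 : ∀ {Γ F X} → Γ ⊢ F → Γ ⊢ X → Sub (Γ ▸ F ▸ X) Γ
sub2 f' x' vz          = x'
sub2 f' x' (vs vz)     = f'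
sub2 f' x' (vs (vs y)) = var y

_[_,_] : ∀ {Γ A F X} → Γ ▸ F ▸ X ⊢ A → Γ ⊢ F → Γ ⊢ X → Γ ⊢ A
e [ f' , x' ] = subst (sub2 f' x') e

seq : ∀ {Γ A B} → Γ ⊢ T A → Γ ⊢ T B → Γ ⊢ T B
seq e e' = bind e (wk e')

map : ∀ {Γ A B} → Γ ⊢ A ⇒ B → Γ ⊢ T A → Γ ⊢ T B
map f m = bind m (ret (app (wk f) (var vz)))

comp : ∀ {Γ A B C} → Γ ⊢ B ⇒ C → Γ ⊢ A ⇒ B → Γ ⊢ A ⇒ C
comp g f = lam (app (wk g) (app (wk f) (var vz)))

setF : ∀ {Γ A} → Γ ⊢ Ref A → Γ ⊢ A ⇒ T unit
setF ℓ = lam (set (wk ℓ) (var vz))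

Cell : Ty → Ty
Cell A = T A ×ᵗ (A ⇒ T unit)

infix 3 _⊢_≈_
data _⊢_≈_ : ∀ {A} (Γ : Ctx) → Γ ⊢ A → Γ ⊢ A → Set where
  ≈-refl  : ∀ {Γ A} {e : Γ ⊢ A} → Γ ⊢ e ≈ e
  ≈-sym   : ∀ {Γ A} {e e' : Γ ⊢ A} → Γ ⊢ e ≈ e' → Γ ⊢ e' ≈ e
  ≈-trans : ∀ {Γ A} {e e' e'' : Γ ⊢ A} → Γ ⊢ e ≈ e' → Γ ⊢ e' ≈ e'' → Γ ⊢ e ≈ e''
  c-lam    : ∀ {Γ A B} {e e' : Γ ▸ A ⊢ B} → Γ ▸ A ⊢ e ≈ e' → Γ ⊢ lam e ≈ lam e'
  c-app    : ∀ {Γ A B} {f f' : Γ ⊢ A ⇒ B} {a a' : Γ ⊢ A} →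
             Γ ⊢ f ≈ f' → Γ ⊢ a ≈ a' → Γ ⊢ app f a ≈ app f' a'
  c-pair   : ∀ {Γ A B} {a a' : Γ ⊢ A} {b b' : Γ ⊢ B} →
             Γ ⊢ a ≈ a' → Γ ⊢ b ≈ b' → Γ ⊢ pair a b ≈ pair a' b'
  c-fst    : ∀ {Γ A B} {p p' : Γ ⊢ A ×ᵗ B} → Γ ⊢ p ≈ p' → Γ ⊢ fst p ≈ fst p'
  c-snd    : ∀ {Γ A B} {p p' : Γ ⊢ A ×ᵗ B} → Γ ⊢ p ≈ p' → Γ ⊢ snd p ≈ snd p'
  c-plus   : ∀ {Γ} {a a' b b' : Γ ⊢ int} →
             Γ ⊢ a ≈ a' → Γ ⊢ b ≈ b' → Γ ⊢ plus a b ≈ plus a' b'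
  c-minus  : ∀ {Γ} {a a' b b' : Γ ⊢ int} →
             Γ ⊢ a ≈ a' → Γ ⊢ b ≈ b' → Γ ⊢ minus a b ≈ minus a' b'
  c-negate : ∀ {Γ} {a a' : Γ ⊢ int} → Γ ⊢ a ≈ a' → Γ ⊢ negate a ≈ negate a'
  c-ret    : ∀ {Γ A} {a a' : Γ ⊢ A} → Γ ⊢ a ≈ a' → Γ ⊢ ret a ≈ ret a'
  c-bind   : ∀ {Γ A B} {m m' : Γ ⊢ T A} {k k' : Γ ▸ A ⊢ T B} →
             Γ ⊢ m ≈ m' → Γ ▸ A ⊢ k ≈ k' → Γ ⊢ bind m k ≈ bind m' k'
  c-alloc  : ∀ {Γ A} {a a' : Γ ⊢ A} → Γ ⊢ a ≈ a' → Γ ⊢ alloc a ≈ alloc a'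
  c-get    : ∀ {Γ A} {r r' : Γ ⊢ Ref A} → Γ ⊢ r ≈ r' → Γ ⊢ get r ≈ get r'
  c-set    : ∀ {Γ A} {r r' : Γ ⊢ Ref A} {a a' : Γ ⊢ A} →
             Γ ⊢ r ≈ r' → Γ ⊢ a ≈ a' → Γ ⊢ set r a ≈ set r' a'
  c-rec    : ∀ {Γ A B} {e e' : Γ ▸ (A ⇒ T B) ▸ A ⊢ T B} →
             Γ ▸ (A ⇒ T B) ▸ A ⊢ e ≈ e' → Γ ⊢ rec e ≈ rec e'
  β-⇒ : ∀ {Γ A B} {e : Γ ▸ A ⊢ B} {a : Γ ⊢ A} → Γ ⊢ app (lam e) a ≈ e [ a ]
  η-⇒ : ∀ {Γ A B} {f : Γ ⊢ A ⇒ B} → Γ ⊢ f ≈ lam (app (wk f) (var vz))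
  β-fst : ∀ {Γ A B} {a : Γ ⊢ A} {b : Γ ⊢ B} → Γ ⊢ fst (pair a b) ≈ a
  β-snd : ∀ {Γ A B} {a : Γ ⊢ A} {b : Γ ⊢ B} → Γ ⊢ snd (pair a b) ≈ b
  η-×   : ∀ {Γ A B} {p : Γ ⊢ A ×ᵗ B} → Γ ⊢ p ≈ pair (fst p) (snd p)
  η-unit : ∀ {Γ} {u : Γ ⊢ unit} → Γ ⊢ u ≈ tt
  +-assoc : ∀ {Γ} {a b c : Γ ⊢ int} → Γ ⊢ plus (plus a b) c ≈ plus a (plus b c)
  +-comm  : ∀ {Γ} {a b : Γ ⊢ int} → Γ ⊢ plus a b ≈ plus b a
  +-idʳ   : ∀ {Γ} {a : Γ ⊢ int} → Γ ⊢ plus a (lit (ℤ.+ 0)) ≈ a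
  +-invʳ  : ∀ {Γ} {a : Γ ⊢ int} → Γ ⊢ plus a (negate a) ≈ lit (ℤ.+ 0)
  minus-def : ∀ {Γ} {a b : Γ ⊢ int} → Γ ⊢ minus a b ≈ plus a (negate b)
  lit-plus  : ∀ {Γ} {m n : ℤ} → Γ ⊢ plus (lit m) (lit n) ≈ lit (m ℤ.+ n)
  lit-minus : ∀ {Γ} {m n : ℤ} → Γ ⊢ minus (lit m) (lit n) ≈ lit (m ℤ.- n)
  lit-neg   : ∀ {Γ} {m : ℤ} → Γ ⊢ negate (lit m) ≈ lit (ℤ.- m)
  m-unitˡ : ∀ {Γ A B} {a : Γ ⊢ A} {k : Γ ▸ A ⊢ T B} → Γ ⊢ bind (ret a) k ≈ k [ a ]
  m-unitʳ : ∀ {Γ A} {m : Γ ⊢ T A} → Γ ⊢ bind m (ret (var vz)) ≈ m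
  m-assoc : ∀ {Γ A B C} {m : Γ ⊢ T A} {k : Γ ▸ A ⊢ T B} {k' : Γ ▸ B ⊢ T C} →
            Γ ⊢ bind (bind m k) k' ≈ bind m (bind k (rename (ext vs) k'))
  step-central : ∀ {Γ A B} {m : Γ ⊢ T A} {k : Γ ▸ A ⊢ T B} →
                 Γ ⊢ seq step (bind m k) ≈ bind m (seq step k)
  rec-unfold : ∀ {Γ A B} {e : Γ ▸ (A ⇒ T B) ▸ A ⊢ T B} {a : Γ ⊢ A} →
               Γ ⊢ app (rec e) a ≈ seq step (e [ rec e , a ])
  set-get   : ∀ {Γ A} {r : Γ ⊢ Ref A} {a : Γ ⊢ A} →
              Γ ⊢ seq (set r a) (get r) ≈ seq step (seq (set r a) (ret a))
  alloc-set : ∀ {Γ A} {a : Γ ⊢ A} →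
              Γ ⊢ bind (alloc a) (seq (set (var vz) (wk a)) (ret (var vz))) ≈ alloc a
  set-set   : ∀ {Γ A} {r : Γ ⊢ Ref A} {a a' : Γ ⊢ A} →
              Γ ⊢ seq (set r a) (set r a') ≈ set r a'
  get-get   : ∀ {Γ A B} {r : Γ ⊢ Ref A} {r' : Γ ⊢ Ref B} →
              Γ ⊢ bind (get r) (bind (get (wk r')) (ret (pair (var (vs vz)) (var vz))))
                ≈ bind (get r') (bind (get (wk r)) (ret (pair (var vz) (var (vs vz)))))
  get-set   : ∀ {Γ A} {r : Γ ⊢ Ref A} →
              Γ ⊢ bind (get r) (seq (set (wk r) (var vz)) (ret (var vz))) ≈ get r
  get-drop  : ∀ {Γ A B} {r : Γ ⊢ Ref A} {e : Γ ⊢ T B} →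
              Γ ⊢ seq (get r) e ≈ seq step e
  alloc-perm : ∀ {Γ A B} {a : Γ ⊢ A} {b : Γ ⊢ B} →
               Γ ⊢ bind (alloc a) (bind (alloc (wk b)) (ret (pair (var (vs vz)) (var vz))))
                 ≈ bind (alloc b) (bind (alloc (wk a)) (ret (pair (var vz) (var (vs vz)))))
  rep-indep : ∀ {Γ A B} {a : Γ ⊢ A} {f⁺ : Γ ⊢ A ⇒ B} {f⁻ : Γ ⊢ B ⇒ A} →
              Γ ▸ B ⊢ app (wk f⁺) (app (wk f⁻) (var vz)) ≈ var vz →
              Γ ▸ A ⊢ app (wk f⁻) (app (wk f⁺) (var vz)) ≈ var vz →
              Γ ⊢ bind (alloc a) (ret (pair (get (var vz)) (setF (var vz))))
                ≈ bind (alloc (app f⁺ a))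
                       (ret (pair (map (wk f⁻) (get (var vz)))
                                  (comp (setF (var vz)) (wk f⁺))))

-- record { incr : T unit ; read : T Int }, encoded as a pair (incr , read)
Counter : Ty
Counter = T unit ×ᵗ T int

negF : ∀ {Γ} → Γ ⊢ int ⇒ int
negF = lam (negate (var vz))

posCounter : ∅ ⊢ T Counter
posCounter =
  bind (alloc (lit (ℤ.+ 0)))
       (ret (pair (bind (get (var vz)) (set (var (vs vz)) (plus (var vz) (lit (ℤ.+ 1)))))
                  (get (var vz))))

negCounter : ∅ ⊢ T Counter
negCounter =
  bind (alloc (lit (ℤ.+ 0)))
       (ret (pair (bind (get (var vz)) (set (var (vs vz)) (minus (var vz) (lit (ℤ.+ 1)))))
                  (map negF (get (var vz)))))

{-# OPTIONS --safe #-}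
-- Both counters are the same client program run against a one-cell store
-- interface ⟨read, write⟩: posCounter uses the cell ⟨get ℓ, set ℓ⟩ with
-- ℓ initialised to 0, negCounter the cell that stores the negation of its
-- contents, ⟨map neg (get ℓ), set ℓ ∘ neg⟩ with ℓ initialised to neg 0.
-- Since neg is an involution, representation independence identifies the two
-- cells, and hence the two counters.
module Submission where

open import Data.Integer as ℤ using (ℤ)
open import Level using (0ℓ)
open import Relation.Binary.Bundles using (Setoid)
import Relation.Binary.Reasoning.Setoid as SetoidReasoning
open import Defs

≈-setoid : Ctx → Ty → Setoid 0ℓ 0ℓ
≈-setoid Γ A = record
  { Carrier       = Γ ⊢ A
  ; _≈_           = λ x y → Γ ⊢ x ≈ y
  ; isEquivalence = record { refl = ≈-refl ; sym = ≈-sym ; trans = ≈-trans }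
  }

module ≈-Reasoning {Γ : Ctx} {A : Ty} = SetoidReasoning (≈-setoid Γ A)

open ≈-Reasoning

zero′ one′ : ∀ {Γ} → Γ ⊢ int
zero′ = lit (ℤ.+ 0)
one′  = lit (ℤ.+ 1)

+-identityˡ : ∀ {Γ} {a : Γ ⊢ int} → Γ ⊢ plus zero′ a ≈ a
+-identityˡ = ≈-trans +-comm +-idʳ

inverseʳ-unique : ∀ {Γ} {a b : Γ ⊢ int} → Γ ⊢ plus a b ≈ zero′ → Γ ⊢ b ≈ negate a
inverseʳ-unique {a = a} {b} a+b≈0 = begin
  b                               ≈⟨ ≈-sym +-idʳ ⟩
  plus b zero′                    ≈⟨ c-plus ≈-refl (≈-sym +-invʳ) ⟩
  plus b (plus a (negate a))      ≈⟨ ≈-sym +-assoc ⟩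
  plus (plus b a) (negate a)      ≈⟨ c-plus (≈-trans +-comm a+b≈0) ≈-refl ⟩
  plus zero′ (negate a)           ≈⟨ +-identityˡ ⟩
  negate a                        ∎

neg-involutive : ∀ {Γ} {a : Γ ⊢ int} → Γ ⊢ negate (negate a) ≈ a
neg-involutive = ≈-sym (inverseʳ-unique (≈-trans +-comm +-invʳ))

+-interchange : ∀ {Γ} {p q r s : Γ ⊢ int} →
                Γ ⊢ plus (plus p q) (plus r s) ≈ plus (plus p r) (plus q s)
+-interchange {p = p} {q} {r} {s} = begin
  plus (plus p q) (plus r s)      ≈⟨ +-assoc ⟩
  plus p (plus q (plus r s))      ≈⟨ c-plus ≈-refl (≈-sym +-assoc) ⟩
  plus p (plus (plus q r) s)      ≈⟨ c-plus ≈-refl (c-plus +-comm ≈-refl) ⟩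
  plus p (plus (plus r q) s)      ≈⟨ c-plus ≈-refl +-assoc ⟩
  plus p (plus r (plus q s))      ≈⟨ ≈-sym +-assoc ⟩
  plus (plus p r) (plus q s)      ∎

neg-distrib-+ : ∀ {Γ} {a b : Γ ⊢ int} → Γ ⊢ negate (plus a b) ≈ plus (negate a) (negate b)
neg-distrib-+ = ≈-sym (inverseʳ-unique
  (≈-trans +-interchange (≈-trans (c-plus +-invʳ +-invʳ) +-idʳ)))

neg-neg-+ : ∀ {Γ} {a b : Γ ⊢ int} → Γ ⊢ negate (plus (negate a) b) ≈ minus a b
neg-neg-+ = ≈-trans neg-distrib-+ (≈-trans (c-plus neg-involutive ≈-refl) (≈-sym minus-def))

negF-involutive : ∀ {Γ} → Γ ▸ int ⊢ app (wk negF) (app (wk negF) (var vz)) ≈ var vz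
negF-involutive = ≈-trans (c-app ≈-refl β-⇒) (≈-trans β-⇒ neg-involutive)

bind-ret-assoc : ∀ {Γ A B C} {m : Γ ⊢ T A} {c : Γ ▸ A ⊢ B} {k : Γ ▸ B ⊢ T C} →
                 Γ ⊢ bind (bind m (ret c)) k ≈ bind m (rename (ext vs) k [ c ])
bind-ret-assoc = ≈-trans m-assoc (c-bind ≈-refl m-unitˡ)

bind-map : ∀ {Γ A B C} {f : Γ ⊢ A ⇒ B} {m : Γ ⊢ T A} {k : Γ ▸ B ⊢ T C} →
           Γ ⊢ bind (map f m) k ≈ bind m (rename (ext vs) k [ app (wk f) (var vz) ])
bind-map = ≈-trans m-assoc (c-bind ≈-refl m-unitˡ)

setF∘negF : ∀ {Γ} {x : Γ ∋ Ref int} {a : Γ ⊢ int} →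
            Γ ⊢ app (comp (setF (var x)) negF) a ≈ set (var x) (negate a)
setF∘negF = ≈-trans β-⇒ (≈-trans β-⇒ (c-set ≈-refl β-⇒))

counterFromCell : ∀ {Γ} → Γ ▸ Cell int ⊢ Counter
counterFromCell =
  pair (bind (fst (var vz)) (app (snd (var (vs vz))) (plus (var vz) one′)))
       (fst (var vz))

refCell : ∀ {Γ} → Γ ▸ Ref int ⊢ Cell int
refCell = pair (get (var vz)) (setF (var vz))

negatedRefCell : ∀ {Γ} → Γ ▸ Ref int ⊢ Cell int
negatedRefCell = pair (map (wk negF) (get (var vz))) (comp (setF (var vz)) (wk negF))

counterOver : ∀ {Γ} → Γ ⊢ int → (Γ ▸ Ref int ⊢ Cell int) → Γ ⊢ T Counter
counterOver a cell = bind (bind (alloc a) (ret cell)) (ret counterFromCell)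

posCounter≈counterOver-refCell : ∅ ⊢ posCounter ≈ counterOver zero′ refCell
posCounter≈counterOver-refCell = ≈-sym (≈-trans bind-ret-assoc
  (c-bind ≈-refl (c-ret (c-pair
    (c-bind β-fst (≈-trans (c-app β-snd ≈-refl) β-⇒))
    β-fst))))

negatedRefCell-incr :
  ∅ ▸ Ref int ⊢ bind (fst negatedRefCell) (app (snd (wk negatedRefCell)) (plus (var vz) one′))
              ≈ bind (get (var vz)) (set (var (vs vz)) (minus (var vz) one′))
negatedRefCell-incr = begin
  bind (fst negatedRefCell) (app (snd (wk negatedRefCell)) (plus (var vz) one′))
    ≈⟨ c-bind β-fst (c-app β-snd ≈-refl) ⟩
  bind (map negF (get (var vz))) (app (comp (setF (var (vs vz))) negF) (plus (var vz) one′))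
    ≈⟨ bind-map ⟩
  bind (get (var vz)) (app (comp (setF (var (vs vz))) negF) (plus (app negF (var vz)) one′))
    ≈⟨ c-bind ≈-refl setF∘negF ⟩
  bind (get (var vz)) (set (var (vs vz)) (negate (plus (app negF (var vz)) one′)))
    ≈⟨ c-bind ≈-refl (c-set ≈-refl (≈-trans (c-negate (c-plus β-⇒ ≈-refl)) neg-neg-+)) ⟩
  bind (get (var vz)) (set (var (vs vz)) (minus (var vz) one′))
    ∎

negCounter≈counterOver-negatedRefCell :
  ∅ ⊢ negCounter ≈ counterOver (app negF zero′) negatedRefCell
negCounter≈counterOver-negatedRefCell = ≈-sym (≈-trans bind-ret-assoc
  (c-bind (c-alloc (≈-trans β-⇒ lit-neg)) (c-ret (c-pair negatedRefCell-incr β-fst))))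

mainTheorem1 : ∅ ⊢ posCounter ≈ negCounter
mainTheorem1 = begin
  posCounter                                   ≈⟨ posCounter≈counterOver-refCell ⟩
  counterOver zero′ refCell                    ≈⟨ c-bind (rep-indep negF-involutive negF-involutive) ≈-refl ⟩
  counterOver (app negF zero′) negatedRefCell  ≈⟨ ≈-sym negCounter≈counterOver-negatedRefCell ⟩
  negCounter                                   ∎
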